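{- Let $n\ge 2$, $m\ge1$, and consider an additive cellular automaton of dimension $n-1$ over $\mathbb{Z}/m\mathbb{Z}$ with weight array $W$ such that $\sigma$ is invertible modulo $m$. Let $a\in\mathbb{Z}/m\mathbb{Z}$ and $d=(d_1,\ldots,d_{n-1})\in(\mathbb{Z}/m\mathbb{Z})^{n-1}$, and let $(a_i)_{i\in\mathbb{Z}^{n-1}\times\mathbb{N}}=\mathcal{O}(\mathrm{AA}(a,d))$. Let $\alpha$ and $s$ be positive integers such that $\alpha$ is divisible by $\mathrm{ord}_m(\sigma)$ and $s\equiv -t\pmod\alpha$ with $t\in[0,n-1]$, let $\varepsilon\in\{ -1,1\}^n$, and let $\triangle(j,\varepsilon,s)$ be an $n$-simplex appearing in this orbit. Then for every $k\in[0,\alpha-1]^n$, the subsimplex $$\mathrm{SS}_k=\{a_{j+\varepsilon\cdot(k+\alpha l)}: l\in\mathbb{N}^n,\ (k_1+\alpha l_1)+\cdots+(k_n+\alpha l_n)\le s-1\}$$ is the arithmetic simplex $$\mathrm{SS}_k=\mathrm{AS}\left(a_{j+\varepsilon\cdot k},\ \alpha\sigma^{j_n+\varepsilon_nk_n}\,\varepsilon\cdot\tilde d,\ \left\lceil\tfrac{s}{\alpha}\right\rceil-\left\lfloor\tfrac{\sum_{u=1}^nk_u+t}{\alpha}\right\rfloor\right),$$ where $\tilde d=\left(d_1,\ldots,d_{n-1},\sigma^{ -1}\sum_{u=1}^{n-1}\sigma_ud_u\right)$.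
   Context: The ACA with integer weight array $W=(w_j)_{j\in[-r,r]^{n-1}}$ maps an array $(a_i)_{i\in\mathbb{Z}^{n-1}}$ of $\mathbb{Z}/m\mathbb{Z}$ to $\left(\sum_jw_ja_{i+j}\right)_i$; $\sigma=\sum_jw_j$, $\sigma_u=\sum_j j_uw_j$. The orbit $\mathcal{O}(A)$ is the array on $\mathbb{Z}^{n-1}\times\mathbb{N}$ whose $j$-th row is $\partial^j(A)$. $\mathrm{AA}(a,d)=(a+\sum_u i_ud_u)_{i\in\mathbb{Z}^{n-1}}$. $\triangle(j,\varepsilon,s)=\{a_{j+\varepsilon\cdot k}: k\in\mathbb{N}^n,\ \sum k_u\le s-1\}$ with $\varepsilon\cdot k$ the componentwise product; it appears in the orbit when all indices lie in $\mathbb{Z}^{n-1}\times\mathbb{N}$. $\mathrm{AS}(b,e,\ell)=\{b+\sum_{u=1}^n i_ue_u: i\in\mathbb{N}^n,\ \sum i_u\le \ell-1\}$ (multiset). $\mathrm{ord}_m(\sigma)$ is the multiplicative order of $\sigma$ modulo $m$. $[0,\alpha-1]=\{0,\ldots,\alpha-1\}$. -}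

module Defs where

open import Data.Nat as ℕ using (ℕ; zero; suc; NonZero)
import Data.Nat.Divisibility as ℕD
open import Data.Integer as ℤ using (ℤ; +_; -[1+_]; 0ℤ; 1ℤ; -1ℤ; _+_; _-_; _*_; -_; _^_)
open import Data.Integer.Divisibility using (_∣_)
open import Data.Fin using (Fin; zero; suc; inject₁; fromℕ)
open import Data.List using (List; map; upTo; foldr)
open import Data.Vec as V using (Vec; lookup; zipWith; tabulate; _∷ʳ_)
open import Data.Product using (Σ; _×_; ∃)
open import Function.Bundles using (_↔_; Inverse)
open import Relation.Nullary using (¬_)
open import Relation.Binary.PropositionalEquality using (_≡_)

-- Z/mZ is modelled by integer representatives up to congruence mod m.

infix 4 _≡_[mod_]
_≡_[mod_] : ℤ → ℤ → ℕ → Set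
a ≡ b [mod m ] = (+ m) ∣ (a - b)

IsMultOrder : ℕ → ℤ → ℕ → Set
IsMultOrder m σ o =
  (0 ℕ.< o) × (σ ^ o ≡ 1ℤ [mod m ]) ×
  (∀ k → 0 ℕ.< k → k ℕ.< o → ¬ (σ ^ k ≡ 1ℤ [mod m ]))

⌈_/_⌉ : ℕ → (α : ℕ) .{{_ : NonZero α}} → ℕ
⌈ s / α ⌉ = (s ℕ.+ (α ℕ.∸ 1)) ℕ./ α

sumℤ : List ℤ → ℤ
sumℤ = foldr _+_ 0ℤ

sumFin : (k : ℕ) → (Fin k → ℤ) → ℤ
sumFin zero    f = 0ℤ
sumFin (suc k) f = f zero + sumFin k (λ u → f (suc u))

range : ℕ → List ℤ
range r = map (λ i → + i - + r) (upTo (suc (2 ℕ.* r)))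

cons : {k : ℕ} → ℤ → (Fin k → ℤ) → Fin (suc k) → ℤ
cons c v zero    = c
cons c v (suc i) = v i

boxSum : (k r : ℕ) → ((Fin k → ℤ) → ℤ) → ℤ
boxSum zero    r f = f (λ ())
boxSum (suc k) r f = sumℤ (map (λ c → boxSum k r (λ v → f (cons c v))) (range r))

-- Additive cellular automata of dimension N (= n-1).
-- A weight array W = (w_j)_{j ∈ [-r,r]^N} is given by r and a function
-- w on ℤ^N (only its values on the box [-r,r]^N are used).

Array : ℕ → Set
Array N = (Fin N → ℤ) → ℤ

step : (N r : ℕ) → Array N → Array N → Array N
step N r w A i = boxSum N r (λ j → w j * A (λ u → i u + j u))

iter : (N r : ℕ) → Array N → ℕ → Array N → Array N
iter N r w zero    A = A
iter N r w (suc t) A = step N r w (iter N r w t A)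

σ : (N r : ℕ) → Array N → ℤ
σ N r w = boxSum N r w

σᵤ : (N r : ℕ) → Array N → Fin N → ℤ
σᵤ N r w u = boxSum N r (λ j → j u * w j)

AA : (N : ℕ) → ℤ → (Fin N → ℤ) → Array N
AA N a d i = a + sumFin N (λ u → i u * d u)

-- entry of the orbit O(A) at position (i , row); the orbit lives on
-- ℤ^N × ℕ, rows with a negative index are outside the orbit (value 0 is a
-- dummy that is never used in a nonempty situation).
orbitAt : (N r : ℕ) → Array N → Array N → (Fin N → ℤ) → ℤ → ℤ
orbitAt N r w A i (+ t)    = iter N r w t A i
orbitAt N r w A i -[1+ _ ] = 0ℤ

-- n-dimensional vectors (n = N+1); the last coordinate is fromℕ N.

vsum : {k : ℕ} → Vec ℕ k → ℕ
vsum = V.foldr _ ℕ._+_ 0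

dot : {k : ℕ} → Vec ℤ k → Vec ℕ k → ℤ
dot e i = V.foldr _ _+_ 0ℤ (zipWith (λ x c → x * + c) e i)

IsSign : ℤ → Set
IsSign e = (e ≡ 1ℤ) Data.Sum.⊎ (e ≡ -1ℤ)
  where import Data.Sum

-- a_{j + ε·c} for j = (jpos , jn) ∈ ℤ^N × ℕ, ε ∈ {±1}^n, c ∈ ℕ^n
entry : (N r : ℕ) → Array N → Array N →
        (Fin N → ℤ) → ℕ → Vec ℤ (suc N) → Vec ℕ (suc N) → ℤ
entry N r w A jpos jn ε c =
  orbitAt N r w A
    (λ u → jpos u + lookup ε (inject₁ u) * + lookup c (inject₁ u))
    (+ jn + lookup ε (fromℕ N) * + lookup c (fromℕ N))

-- the simplex △(j,ε,s) appears in the orbit: every index j + ε·k with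
-- k ∈ ℕ^n, Σ k_u ≤ s-1, lies in ℤ^N × ℕ (i.e. its last coordinate is ≥ 0)
Appears : (N : ℕ) → ℕ → Vec ℤ (suc N) → ℕ → Set
Appears N jn ε s =
  ∀ (k : Vec ℕ (suc N)) → vsum k ℕ.≤ s ℕ.∸ 1 →
    0ℤ ℤ.≤ + jn + lookup ε (fromℕ N) * + lookup k (fromℕ N)

-- σ^e for e ∈ ℤ, where σinv is an inverse of σ modulo m
powℤ : ℤ → ℤ → ℤ → ℤ
powℤ s sinv (+ e)    = s ^ e
powℤ s sinv -[1+ e ] = sinv ^ suc e

-- Finite multisets of elements of ℤ/mℤ are given as families
-- (index type, value map); two such are equal as multisets iff there is a
-- bijection of the index types preserving values modulo m.

record Family : Set₁ where
  constructor fam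
  field
    Idx : Set
    val : Idx → ℤ

MultisetEq : ℕ → Family → Family → Set
MultisetEq m (fam I f) (fam J g) =
  Σ (I ↔ J) λ e → ∀ x → f x ≡ g (Inverse.to e x) [mod m ]

AS : (n : ℕ) → ℤ → Vec ℤ n → ℤ → Family
AS n b e ℓ = fam (Σ (Vec ℕ n) λ i → + vsum i ℤ.≤ ℓ - 1ℤ)
                 (λ p → b + dot e (Data.Product.proj₁ p))
  where import Data.Product

SS : (N r : ℕ) → Array N → Array N → (Fin N → ℤ) → ℕ → Vec ℤ (suc N) →
     ℕ → ℕ → Vec ℕ (suc N) → Family
SS N r w A jpos jn ε α s k =
  fam (Σ (Vec ℕ (suc N)) λ l → vsum (kαl l) ℕ.≤ s ℕ.∸ 1)
      (λ p → entry N r w A jpos jn ε (kαl (Data.Product.proj₁ p)))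
  where
  import Data.Product
  kαl : Vec ℕ (suc N) → Vec ℕ (suc N)
  kαl l = zipWith (λ ku lu → ku ℕ.+ α ℕ.* lu) k l

dTilde : (N r : ℕ) → Array N → ℤ → (Fin N → ℤ) → Vec ℤ (suc N)
dTilde N r w σinv d = tabulate d ∷ʳ (σinv * sumFin N (λ u → σᵤ N r w u * d u))

-- One step of the ACA maps the array b + c·⟨i,d⟩ to σ b + c Σ_u σ_u d_u + σ c·⟨i,d⟩, so
-- modulo m the entry of O(AA(a,d)) at (i, T) is σ^T (a + ⟨i,d⟩ + T c), c = σ⁻¹ Σ_u σ_u d_u.
-- Since σ^α ≡ 1, moving from j + ε·k by ε·(α l) leaves the power σ^T unchanged and adds
-- α σ^T (ε·d̃)·l, so SS_k is an arithmetic simplex indexed by the same l. With K = Σ k_u,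
-- K + t = ρ + p α (ρ < α) and s + t = q α, q = ⌈s/α⌉, the constraint K + α Σl ≤ s - 1 becomes
-- ρ + (p + Σl) α < q α, i.e. Σl ≤ q - p - 1.

module Submission where

open import Defs
open import Data.Nat as ℕ using (ℕ; suc; NonZero; _≤_; _<_)
open import Data.Nat.Divisibility as ℕD using ()
open import Data.Integer as ℤ using (ℤ; +_; 1ℤ; _*_; -_; _-_; _+_)
open import Data.Fin using (Fin; fromℕ)
open import Data.Vec using (Vec; lookup; zipWith; map)
open import Data.Vec.Relation.Unary.All using (All)
open import Data.Product using (∃; _×_)

open import Data.Nat using (zero; s≤s)
open import Data.Integer using (0ℤ; -1ℤ; _^_)
open import Data.Integer.Tactic.RingSolver using (solve-∀)
import Data.Nat.Tactic.RingSolver as ℕSolver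
open import Data.Fin using (zero; suc; inject₁)
open import Data.List using ([]; _∷_) renaming (map to mapᴸ)
open import Data.Vec using ([]; _∷_; tabulate; _∷ʳ_)
open import Data.Vec.Relation.Unary.All.Properties using (lookup⁺)
open import Data.Product using (Σ; _,_)
open import Data.Sum using (_⊎_; inj₁; inj₂)
open import Function.Bundles using (_⇔_; _↔_; mk⇔; mk↔ₛ′; Equivalence)
open import Function.Construct.Composition using (_⇔-∘_)
open import Function.Construct.Symmetry using (⇔-sym)
open import Level using (0ℓ)
open import Relation.Binary.Bundles using (Setoid)
open import Relation.Binary.PropositionalEquality
open import Relation.Nullary using (Irrelevant)
import Relation.Binary.Reasoning.Setoid as SetoidReasoning
import Data.Nat.Properties as ℕP
import Data.Nat.DivMod as DivMod
import Data.Integer.Properties as ℤP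
import Data.Integer.Divisibility.Signed as ℤD
import Data.Vec.Properties as VecP
open import Algebra.Properties.CommutativeSemigroup ℤP.+-commutativeSemigroup using (interchange)

sumℤ-map-cong : ∀ {A : Set} {f g : A → ℤ} → (∀ x → f x ≡ g x) →
                ∀ xs → sumℤ (mapᴸ f xs) ≡ sumℤ (mapᴸ g xs)
sumℤ-map-cong f≗g []       = refl
sumℤ-map-cong f≗g (x ∷ xs) = cong₂ _+_ (f≗g x) (sumℤ-map-cong f≗g xs)

sumℤ-map-+ : ∀ {A : Set} (f g : A → ℤ) xs →
             sumℤ (mapᴸ (λ x → f x + g x) xs) ≡ sumℤ (mapᴸ f xs) + sumℤ (mapᴸ g xs)
sumℤ-map-+ f g []       = refl
sumℤ-map-+ f g (x ∷ xs) =
  trans (cong (_+_ (f x + g x)) (sumℤ-map-+ f g xs)) (interchange (f x) (g x) _ _)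

sumℤ-map-*ˡ : ∀ {A : Set} c (f : A → ℤ) xs →
              sumℤ (mapᴸ (λ x → c * f x) xs) ≡ c * sumℤ (mapᴸ f xs)
sumℤ-map-*ˡ c f []       = sym (ℤP.*-zeroʳ c)
sumℤ-map-*ˡ c f (x ∷ xs) =
  trans (cong (_+_ (c * f x)) (sumℤ-map-*ˡ c f xs)) (sym (ℤP.*-distribˡ-+ c (f x) _))

boxSum-cong : ∀ k r {f g : (Fin k → ℤ) → ℤ} → (∀ j → f j ≡ g j) → boxSum k r f ≡ boxSum k r g
boxSum-cong zero    r f≗g = f≗g _
boxSum-cong (suc k) r f≗g = sumℤ-map-cong (λ c → boxSum-cong k r (λ v → f≗g (cons c v))) (range r)

boxSum-+ : ∀ k r (f g : (Fin k → ℤ) → ℤ) →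
           boxSum k r (λ j → f j + g j) ≡ boxSum k r f + boxSum k r g
boxSum-+ zero    r f g = refl
boxSum-+ (suc k) r f g =
  trans (sumℤ-map-cong (λ c → boxSum-+ k r (λ v → f (cons c v)) (λ v → g (cons c v))) (range r))
        (sumℤ-map-+ (λ c → boxSum k r (λ v → f (cons c v))) (λ c → boxSum k r (λ v → g (cons c v))) (range r))

boxSum-*ˡ : ∀ k r c (f : (Fin k → ℤ) → ℤ) → boxSum k r (λ j → c * f j) ≡ c * boxSum k r f
boxSum-*ˡ zero    r c f = refl
boxSum-*ˡ (suc k) r c f =
  trans (sumℤ-map-cong (λ x → boxSum-*ˡ k r c (λ v → f (cons x v))) (range r))
        (sumℤ-map-*ˡ c (λ x → boxSum k r (λ v → f (cons x v))) (range r))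

boxSum-zero : ∀ k r → boxSum k r (λ _ → 0ℤ) ≡ 0ℤ
boxSum-zero k r = trans (boxSum-*ˡ k r 0ℤ (λ _ → 0ℤ)) (ℤP.*-zeroˡ (boxSum k r (λ _ → 0ℤ)))

sumFin-cong : ∀ n {f g : Fin n → ℤ} → (∀ u → f u ≡ g u) → sumFin n f ≡ sumFin n g
sumFin-cong zero    f≗g = refl
sumFin-cong (suc n) f≗g = cong₂ _+_ (f≗g zero) (sumFin-cong n (λ u → f≗g (suc u)))

sumFin-+ : ∀ n (f g : Fin n → ℤ) → sumFin n (λ u → f u + g u) ≡ sumFin n f + sumFin n g
sumFin-+ zero    f g = refl
sumFin-+ (suc n) f g =
  trans (cong (_+_ (f zero + g zero)) (sumFin-+ n _ _)) (interchange (f zero) (g zero) _ _)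

sumFin-*ˡ : ∀ n c (f : Fin n → ℤ) → sumFin n (λ u → c * f u) ≡ c * sumFin n f
sumFin-*ˡ zero    c f = sym (ℤP.*-zeroʳ c)
sumFin-*ˡ (suc n) c f =
  trans (cong (_+_ (c * f zero)) (sumFin-*ˡ n c _)) (sym (ℤP.*-distribˡ-+ c (f zero) _))

boxSum-sumFin : ∀ k r n (F : (Fin k → ℤ) → Fin n → ℤ) →
                boxSum k r (λ j → sumFin n (F j)) ≡ sumFin n (λ u → boxSum k r (λ j → F j u))
boxSum-sumFin k r zero    F = boxSum-zero k r
boxSum-sumFin k r (suc n) F =
  trans (boxSum-+ k r _ _) (cong (_+_ (boxSum k r (λ j → F j zero))) (boxSum-sumFin k r n (λ j u → F j (suc u))))

module Congruence (m : ℕ) where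

  -- A record, unlike _≡_[mod_], so that x and y can be inferred from x ≈ y.
  infix 4 _≈_
  record _≈_ (x y : ℤ) : Set where
    constructor mod-divides
    field divides-difference : + m ℤD.∣ x - y
  open _≈_

  ≈⇒≡-mod : ∀ {x y} → x ≈ y → x ≡ y [mod m ]
  ≈⇒≡-mod x≈y = ℤD.∣⇒∣ᵤ (divides-difference x≈y)

  ≡-mod⇒≈ : ∀ {x y} → x ≡ y [mod m ] → x ≈ y
  ≡-mod⇒≈ x≡y = mod-divides (ℤD.∣ᵤ⇒∣ x≡y)

  private
    by-difference : ∀ {x y z} → x - y ≡ z → + m ℤD.∣ z → x ≈ y
    by-difference refl m∣z = mod-divides m∣z

  ≈-reflexive : ∀ {x y} → x ≡ y → x ≈ y
  ≈-reflexive {x} refl = by-difference (ℤP.+-inverseʳ x) (ℤD.divides 0ℤ refl)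

  ≈-refl : ∀ {x} → x ≈ x
  ≈-refl = ≈-reflexive refl

  ≈-sym : ∀ {x y} → x ≈ y → y ≈ x
  ≈-sym {x} {y} x≈y = by-difference (swap y x) (ℤD.∣m⇒∣-m (divides-difference x≈y))
    where swap : ∀ y x → y - x ≡ - (x - y)
          swap = solve-∀

  ≈-trans : ∀ {x y z} → x ≈ y → y ≈ z → x ≈ z
  ≈-trans {x} {y} {z} x≈y y≈z =
    by-difference (telescope x y z) (ℤD.∣m∣n⇒∣m+n (divides-difference x≈y) (divides-difference y≈z))
    where telescope : ∀ x y z → x - z ≡ (x - y) + (y - z)
          telescope = solve-∀

  +-cong : ∀ {x y u v} → x ≈ y → u ≈ v → x + u ≈ y + v
  +-cong {x} {y} {u} {v} x≈y u≈v =
    by-difference (split x y u v) (ℤD.∣m∣n⇒∣m+n (divides-difference x≈y) (divides-difference u≈v))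
    where split : ∀ x y u v → (x + u) - (y + v) ≡ (x - y) + (u - v)
          split = solve-∀

  *-cong : ∀ {x y u v} → x ≈ y → u ≈ v → x * u ≈ y * v
  *-cong {x} {y} {u} {v} x≈y u≈v =
    by-difference (split x y u v)
      (ℤD.∣m∣n⇒∣m+n (ℤD.∣n⇒∣m*n u (divides-difference x≈y)) (ℤD.∣n⇒∣m*n y (divides-difference u≈v)))
    where split : ∀ x y u v → x * u - y * v ≡ u * (x - y) + y * (u - v)
          split = solve-∀

  *-congˡ : ∀ x {u v} → u ≈ v → x * u ≈ x * v
  *-congˡ x = *-cong (≈-refl {x})

  *-congʳ : ∀ u {x y} → x ≈ y → x * u ≈ y * u
  *-congʳ u x≈y = *-cong x≈y (≈-refl {u})

  +-congʳ : ∀ u {x y} → x ≈ y → x + u ≈ y + u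
  +-congʳ u x≈y = +-cong x≈y (≈-refl {u})

  ≈-setoid : Setoid 0ℓ 0ℓ
  ≈-setoid = record
    { Carrier       = ℤ
    ; _≈_           = _≈_
    ; isEquivalence = record { refl = ≈-refl ; sym = ≈-sym ; trans = ≈-trans }
    }

  ^-≈1 : ∀ {x} n → x ≈ 1ℤ → x ^ n ≈ 1ℤ
  ^-≈1 zero    x≈1 = ≈-refl
  ^-≈1 (suc n) x≈1 = *-cong x≈1 (^-≈1 n x≈1)

  ^-≈1-multiple : ∀ {x o α} → x ^ o ≈ 1ℤ → o ℕD.∣ α → x ^ α ≈ 1ℤ
  ^-≈1-multiple {x} {o} xᵒ≈1 (ℕD.divides q refl) =
    ≈-trans (≈-reflexive (sym (trans (ℤP.^-*-assoc x o q) (cong (x ^_) (ℕP.*-comm o q)))))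
            (^-≈1 q xᵒ≈1)

  ^-periodic : ∀ {x α} → x ^ α ≈ 1ℤ → ∀ T l → x ^ (T ℕ.+ α ℕ.* l) ≈ x ^ T
  ^-periodic {x} {α} xᵅ≈1 T l = ≈-trans
    (≈-reflexive (trans (ℤP.^-distribˡ-+-* x T (α ℕ.* l)) (cong (x ^ T *_) (sym (ℤP.^-*-assoc x α l)))))
    (≈-trans (*-congˡ (x ^ T) (^-≈1 l xᵅ≈1)) (≈-reflexive (ℤP.*-identityʳ (x ^ T))))

vsum-zipWith-+-* : ∀ α {n} (k l : Vec ℕ n) →
                   vsum (zipWith (λ ku lu → ku ℕ.+ α ℕ.* lu) k l) ≡ vsum k ℕ.+ α ℕ.* vsum l
vsum-zipWith-+-* α []       []       = sym (ℕP.*-zeroʳ α)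
vsum-zipWith-+-* α (x ∷ k) (y ∷ l) =
  trans (cong (ℕ._+_ (x ℕ.+ α ℕ.* y)) (vsum-zipWith-+-* α k l)) (regroup x α y (vsum k) (vsum l))
  where regroup : ∀ x α y K L → x ℕ.+ α ℕ.* y ℕ.+ (K ℕ.+ α ℕ.* L) ≡ x ℕ.+ K ℕ.+ α ℕ.* (y ℕ.+ L)
        regroup = ℕSolver.solve-∀

dot-map-*ˡ : ∀ x {n} (e : Vec ℤ n) (l : Vec ℕ n) → dot (map (x *_) e) l ≡ x * dot e l
dot-map-*ˡ x []      []      = sym (ℤP.*-zeroʳ x)
dot-map-*ˡ x (y ∷ e) (k ∷ l) =
  trans (cong (_+_ (x * y * + k)) (dot-map-*ˡ x e l)) (factor x y (+ k) (dot e l))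
  where factor : ∀ x y k D → x * y * k + x * D ≡ x * (y * k + D)
        factor = solve-∀

dot-split-last : ∀ n (e : Vec ℤ (suc n)) (l : Vec ℕ (suc n)) →
  dot e l ≡ sumFin n (λ u → lookup e (inject₁ u) * + lookup l (inject₁ u))
            + lookup e (fromℕ n) * + lookup l (fromℕ n)
dot-split-last zero    (x ∷ []) (k ∷ []) = ℤP.+-comm (x * + k) 0ℤ
dot-split-last (suc n) (x ∷ e)  (k ∷ l)  =
  trans (cong (_+_ (x * + k)) (dot-split-last n e l)) (sym (ℤP.+-assoc (x * + k) _ _))

lookup-∷ʳ-inject₁ : ∀ {A : Set} {n} (v : Vec A n) x (u : Fin n) → lookup (v ∷ʳ x) (inject₁ u) ≡ lookup v u
lookup-∷ʳ-inject₁ (y ∷ v) x zero    = refl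
lookup-∷ʳ-inject₁ (y ∷ v) x (suc u) = lookup-∷ʳ-inject₁ v x u

lookup-∷ʳ-last : ∀ {A : Set} {n} (v : Vec A n) x → lookup (v ∷ʳ x) (fromℕ n) ≡ x
lookup-∷ʳ-last []      x = refl
lookup-∷ʳ-last (y ∷ v) x = lookup-∷ʳ-last v x

dot-zipWith-*-∷ʳ : ∀ n (ε : Vec ℤ (suc n)) (f : Fin n → ℤ) y (l : Vec ℕ (suc n)) →
  dot (zipWith _*_ ε (tabulate f ∷ʳ y)) l
    ≡ sumFin n (λ u → lookup ε (inject₁ u) * f u * + lookup l (inject₁ u))
      + lookup ε (fromℕ n) * y * + lookup l (fromℕ n)
dot-zipWith-*-∷ʳ n ε f y l = trans (dot-split-last n (zipWith _*_ ε (tabulate f ∷ʳ y)) l) (cong₂ _+_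
  (sumFin-cong n (λ u → cong (_* + lookup l (inject₁ u)) (begin
    lookup (zipWith _*_ ε (tabulate f ∷ʳ y)) (inject₁ u)
      ≡⟨ VecP.lookup-zipWith _*_ (inject₁ u) ε (tabulate f ∷ʳ y) ⟩
    lookup ε (inject₁ u) * lookup (tabulate f ∷ʳ y) (inject₁ u)
      ≡⟨ cong (lookup ε (inject₁ u) *_) (trans (lookup-∷ʳ-inject₁ (tabulate f) y u) (VecP.lookup∘tabulate f u)) ⟩
    lookup ε (inject₁ u) * f u ∎)))
  (cong (_* + lookup l (fromℕ n))
    (trans (VecP.lookup-zipWith _*_ (fromℕ n) ε (tabulate f ∷ʳ y))
           (cong (lookup ε (fromℕ n) *_) (lookup-∷ʳ-last (tabulate f) y)))))
  where open ≡-Reasoning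

⌈m/n⌉*n≡m+o : ∀ m n o .{{_ : NonZero n}} → o < n → n ℕD.∣ m ℕ.+ o → ⌈ m / n ⌉ ℕ.* n ≡ m ℕ.+ o
⌈m/n⌉*n≡m+o m (suc n′) o (s≤s o≤n′) n∣m+o = begin
  (m ℕ.+ n′) ℕ./ suc n′ ℕ.* suc n′
    ≡⟨ cong (λ x → x ℕ./ suc n′ ℕ.* suc n′) m+n′≡e+[m+o] ⟩
  (e ℕ.+ (m ℕ.+ o)) ℕ./ suc n′ ℕ.* suc n′
    ≡⟨ cong (ℕ._* suc n′) (DivMod.+-distrib-/-∣ʳ e n∣m+o) ⟩
  (e ℕ./ suc n′ ℕ.+ (m ℕ.+ o) ℕ./ suc n′) ℕ.* suc n′
    ≡⟨ cong (λ x → (x ℕ.+ (m ℕ.+ o) ℕ./ suc n′) ℕ.* suc n′) (DivMod.m<n⇒m/n≡0 e<n) ⟩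
  (m ℕ.+ o) ℕ./ suc n′ ℕ.* suc n′
    ≡⟨ DivMod.m/n*n≡m n∣m+o ⟩
  m ℕ.+ o ∎
  where
  open ≡-Reasoning
  e = n′ ℕ.∸ o
  e<n : e < suc n′
  e<n = s≤s (ℕP.m∸n≤m n′ o)
  m+n′≡e+[m+o] : m ℕ.+ n′ ≡ e ℕ.+ (m ℕ.+ o)
  m+n′≡e+[m+o] = trans (cong (ℕ._+_ m) (sym (ℕP.m∸n+n≡m o≤n′))) (regroup m e o)
    where regroup : ∀ m e o → m ℕ.+ (e ℕ.+ o) ≡ e ℕ.+ (m ℕ.+ o)
          regroup = ℕSolver.solve-∀

m+n*o<p*o⇔n<p : ∀ {m n o p} → m < o → m ℕ.+ n ℕ.* o < p ℕ.* o ⇔ n < p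
m+n*o<p*o⇔n<p {m} {n} {o} {p} m<o = mk⇔
  (λ m+no<po → ℕP.*-cancelʳ-< o n p (ℕP.≤-<-trans (ℕP.m≤n+m (n ℕ.* o) m) m+no<po))
  (λ n<p → begin-strict
    m ℕ.+ n ℕ.* o  <⟨ ℕP.+-monoˡ-< (n ℕ.* o) m<o ⟩
    suc n ℕ.* o    ≤⟨ ℕP.*-monoˡ-≤ o n<p ⟩
    p ℕ.* o        ∎)
  where open ℕP.≤-Reasoning

fits⇔ : ∀ {α} .{{_ : NonZero α}} {s t} K L → t < α → α ℕD.∣ suc s ℕ.+ t →
        K ℕ.+ α ℕ.* L ≤ s ⇔ (K ℕ.+ t) ℕ./ α ℕ.+ L < ⌈ suc s / α ⌉
fits⇔ {α} {s} {t} K L t<α α∣s+t = mk⇔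
  (λ fits → to (m+n*o<p*o⇔n<p ρ<α) (subst₂ _<_ lhs rhs (ℕP.+-monoˡ-< t (s≤s fits))))
  (λ p+L<q → ℕP.≤-pred (ℕP.+-cancelʳ-< t _ _
               (subst₂ _<_ (sym lhs) (sym rhs) (from (m+n*o<p*o⇔n<p ρ<α) p+L<q))))
  where
  open Equivalence
  ρ = (K ℕ.+ t) ℕ.% α
  p = (K ℕ.+ t) ℕ./ α
  ρ<α : ρ < α
  ρ<α = DivMod.m%n<n (K ℕ.+ t) α
  lhs : K ℕ.+ α ℕ.* L ℕ.+ t ≡ ρ ℕ.+ (p ℕ.+ L) ℕ.* α
  lhs = trans (regroup K α L t)
              (trans (cong (ℕ._+ L ℕ.* α) (DivMod.m≡m%n+[m/n]*n (K ℕ.+ t) α)) (regroup′ ρ p L α))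
    where regroup : ∀ K α L t → K ℕ.+ α ℕ.* L ℕ.+ t ≡ K ℕ.+ t ℕ.+ L ℕ.* α
          regroup = ℕSolver.solve-∀
          regroup′ : ∀ ρ p L α → ρ ℕ.+ p ℕ.* α ℕ.+ L ℕ.* α ≡ ρ ℕ.+ (p ℕ.+ L) ℕ.* α
          regroup′ = ℕSolver.solve-∀
  rhs : suc s ℕ.+ t ≡ ⌈ suc s / α ⌉ ℕ.* α
  rhs = sym (⌈m/n⌉*n≡m+o (suc s) α t t<α α∣s+t)

+L≤+q-+p-1⇔p+L<q : ∀ L p q → + L ℤ.≤ + q - + p - 1ℤ ⇔ p ℕ.+ L < q
+L≤+q-+p-1⇔p+L<q L p q = mk⇔
  (λ L≤ → subst (_≤ q) (trans (ℕP.+-suc L p) (cong suc (ℕP.+-comm L p)))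
            (ℤP.drop‿+≤+ (ℤP.≤-trans (ℤP.+-monoˡ-≤ (1ℤ + + p) L≤) (ℤP.≤-reflexive (cancel (+ q) (+ p))))))
  (λ p+L<q → ℤP.≤-trans (ℤP.≤-reflexive (cancel′ (+ L) (+ p)))
               (ℤP.≤-trans (ℤP.+-monoˡ-≤ (- (1ℤ + + p)) (ℤ.+≤+ p+L<q)) (ℤP.≤-reflexive (regroup (+ q) (+ p)))))
  where
  cancel : ∀ q p → q - p - 1ℤ + (1ℤ + p) ≡ q
  cancel = solve-∀
  cancel′ : ∀ L p → L ≡ 1ℤ + p + L - (1ℤ + p)
  cancel′ = solve-∀
  regroup : ∀ q p → q - (1ℤ + p) ≡ q - p - 1ℤ
  regroup = solve-∀

≡-neg-mod⇒∣+ : ∀ {s t α} → + s ≡ - (+ t) [mod α ] → α ℕD.∣ s ℕ.+ t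
≡-neg-mod⇒∣+ {s} {t} {α} s≡-t = subst (λ x → α ℕD.∣ ℤ.∣ + s + x ∣) (ℤP.neg-involutive (+ t)) s≡-t

Σ-↔-⇔ : ∀ {A : Set} {P Q : A → Set} → (∀ {x} → Irrelevant (P x)) → (∀ {x} → Irrelevant (Q x)) →
        (∀ x → P x ⇔ Q x) → Σ A P ↔ Σ A Q
Σ-↔-⇔ P-irr Q-irr P⇔Q = mk↔ₛ′
  (λ (x , p) → x , Equivalence.to (P⇔Q x) p)
  (λ (x , q) → x , Equivalence.from (P⇔Q x) q)
  (λ (x , q) → cong (x ,_) (Q-irr _ q))
  (λ (x , p) → cong (x ,_) (P-irr _ p))

module OrbitOfAA (N r : ℕ) (w : Array N) (a : ℤ) (d : Fin N → ℤ) where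

  σ₀ : ℤ
  σ₀ = σ N r w

  D : ℤ
  D = sumFin N (λ u → σᵤ N r w u * d u)

  ⟪_⟫ : (Fin N → ℤ) → ℤ
  ⟪ i ⟫ = sumFin N (λ u → i u * d u)

  ⟪⟫-+ : ∀ i j → ⟪ (λ u → i u + j u) ⟫ ≡ ⟪ i ⟫ + ⟪ j ⟫
  ⟪⟫-+ i j = trans (sumFin-cong N (λ u → ℤP.*-distribʳ-+ (d u) (i u) (j u)))
                   (sumFin-+ N (λ u → i u * d u) (λ u → j u * d u))

  boxSum-*⟪⟫ : boxSum N r (λ j → w j * ⟪ j ⟫) ≡ D
  boxSum-*⟪⟫ = begin
    boxSum N r (λ j → w j * ⟪ j ⟫)
      ≡⟨ boxSum-cong N r (λ j → sym (sumFin-*ˡ N (w j) (λ u → j u * d u))) ⟩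
    boxSum N r (λ j → sumFin N (λ u → w j * (j u * d u)))
      ≡⟨ boxSum-sumFin N r N (λ j u → w j * (j u * d u)) ⟩
    sumFin N (λ u → boxSum N r (λ j → w j * (j u * d u)))
      ≡⟨ sumFin-cong N (λ u → trans (boxSum-cong N r (λ j → reorder (w j) (j u) (d u)))
                                      (boxSum-*ˡ N r (d u) (λ j → j u * w j))) ⟩
    sumFin N (λ u → d u * σᵤ N r w u)
      ≡⟨ sumFin-cong N (λ u → ℤP.*-comm (d u) (σᵤ N r w u)) ⟩
    D ∎
    where
    open ≡-Reasoning
    reorder : ∀ w j d → w * (j * d) ≡ d * (j * w)
    reorder = solve-∀

  step-cong : ∀ {A B : Array N} → (∀ i → A i ≡ B i) → ∀ i → step N r w A i ≡ step N r w B i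
  step-cong A≗B i = boxSum-cong N r (λ j → cong (w j *_) (A≗B (λ u → i u + j u)))

  step-affine : ∀ b c i →
    step N r w (λ i → b + c * ⟪ i ⟫) i ≡ σ₀ * b + c * D + σ₀ * c * ⟪ i ⟫
  step-affine b c i = begin
    boxSum N r (λ j → w j * (b + c * ⟪ (λ u → i u + j u) ⟫))
      ≡⟨ boxSum-cong N r (λ j → cong (λ x → w j * (b + c * x)) (⟪⟫-+ i j)) ⟩
    boxSum N r (λ j → w j * (b + c * (⟪ i ⟫ + ⟪ j ⟫)))
      ≡⟨ boxSum-cong N r (λ j → distribute (w j) b c ⟪ i ⟫ ⟪ j ⟫) ⟩
    boxSum N r (λ j → (b + c * ⟪ i ⟫) * w j + c * (w j * ⟪ j ⟫))
      ≡⟨ boxSum-+ N r (λ j → (b + c * ⟪ i ⟫) * w j) (λ j → c * (w j * ⟪ j ⟫)) ⟩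
    boxSum N r (λ j → (b + c * ⟪ i ⟫) * w j) + boxSum N r (λ j → c * (w j * ⟪ j ⟫))
      ≡⟨ cong₂ _+_ (boxSum-*ˡ N r (b + c * ⟪ i ⟫) w)
                   (trans (boxSum-*ˡ N r c (λ j → w j * ⟪ j ⟫)) (cong (c *_) boxSum-*⟪⟫)) ⟩
    (b + c * ⟪ i ⟫) * σ₀ + c * D
      ≡⟨ collect b c ⟪ i ⟫ σ₀ D ⟩
    σ₀ * b + c * D + σ₀ * c * ⟪ i ⟫ ∎
    where
    open ≡-Reasoning
    distribute : ∀ w b c x y → w * (b + c * (x + y)) ≡ (b + c * x) * w + c * (w * y)
    distribute = solve-∀
    collect : ∀ b c x σ D → (b + c * x) * σ + c * D ≡ σ * b + c * D + σ * c * x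
    collect = solve-∀

  offset : ℕ → ℤ
  offset zero    = a
  offset (suc t) = σ₀ * offset t + σ₀ ^ t * D

  iter-AA : ∀ t i → iter N r w t (AA N a d) i ≡ offset t + σ₀ ^ t * ⟪ i ⟫
  iter-AA zero    i = cong (_+_ a) (sym (ℤP.*-identityˡ ⟪ i ⟫))
  iter-AA (suc t) i = trans (step-cong (iter-AA t) i) (step-affine (offset t) (σ₀ ^ t) i)

  ⟪⟫-translate : ∀ α {i₀ i} (ε′ : Fin N → ℤ) (l′ : Fin N → ℕ) →
                 (∀ u → i u ≡ i₀ u + ε′ u * (+ α * + l′ u)) →
                 ⟪ i ⟫ ≡ ⟪ i₀ ⟫ + + α * sumFin N (λ u → ε′ u * d u * + l′ u)
  ⟪⟫-translate α {i₀} {i} ε′ l′ i≡ = begin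
    ⟪ i ⟫
      ≡⟨ sumFin-cong N (λ u → cong (_* d u) (i≡ u)) ⟩
    ⟪ (λ u → i₀ u + ε′ u * (+ α * + l′ u)) ⟫
      ≡⟨ ⟪⟫-+ i₀ (λ u → ε′ u * (+ α * + l′ u)) ⟩
    ⟪ i₀ ⟫ + ⟪ (λ u → ε′ u * (+ α * + l′ u)) ⟫
      ≡⟨ cong (_+_ ⟪ i₀ ⟫) (trans (sumFin-cong N (λ u → reorder (ε′ u) (+ α) (+ l′ u) (d u)))
                                 (sumFin-*ˡ N (+ α) (λ u → ε′ u * d u * + l′ u))) ⟩
    ⟪ i₀ ⟫ + + α * sumFin N (λ u → ε′ u * d u * + l′ u) ∎
    where
    open ≡-Reasoning
    reorder : ∀ e A l d → e * (A * l) * d ≡ A * (e * d * l)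
    reorder = solve-∀

signed-shift : ∀ {ε} → IsSign ε → ∀ {T T₀} n → + T ≡ + T₀ + ε * + n → T ≡ T₀ ℕ.+ n ⊎ T₀ ≡ T ℕ.+ n
signed-shift (inj₁ refl) {T₀ = T₀} n T≡T₀+n =
  inj₁ (ℤP.+-injective (trans T≡T₀+n (cong (_+_ (+ T₀)) (ℤP.*-identityˡ (+ n)))))
signed-shift (inj₂ refl) {T₀ = T₀} n T≡T₀-n =
  inj₂ (ℤP.+-injective (trans (cancel (+ T₀) (+ n)) (cong (λ x → x + + n) (sym T≡T₀-n))))
  where cancel : ∀ x n → x ≡ x + -1ℤ * n + n
        cancel = solve-∀

module RowsModulo (N r : ℕ) (w : Array N) (a : ℤ) (d : Fin N → ℤ)
                  (m : ℕ) (σinv : ℤ) (σσinv≈1 : Congruence._≈_ m (σ N r w * σinv) 1ℤ) where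

  open OrbitOfAA N r w a d
  open Congruence m
  open SetoidReasoning ≈-setoid

  c : ℤ
  c = σinv * D

  D≈σ*c : D ≈ σ₀ * c
  D≈σ*c = begin
    D                  ≡⟨ sym (ℤP.*-identityˡ D) ⟩
    1ℤ * D             ≈⟨ *-congʳ D (≈-sym σσinv≈1) ⟩
    σ₀ * σinv * D      ≡⟨ ℤP.*-assoc σ₀ σinv D ⟩
    σ₀ * c             ∎

  offset≈ : ∀ t → offset t ≈ σ₀ ^ t * (a + + t * c)
  offset≈ zero    = ≈-reflexive (initial-row a c)
    where initial-row : ∀ a c → a ≡ 1ℤ * (a + 0ℤ * c)
          initial-row = solve-∀
  offset≈ (suc t) = begin
    σ₀ * offset t + σ₀ ^ t * D                        ≈⟨ +-cong (*-congˡ σ₀ (offset≈ t)) (*-congˡ (σ₀ ^ t) D≈σ*c) ⟩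
    σ₀ * (σ₀ ^ t * (a + + t * c)) + σ₀ ^ t * (σ₀ * c) ≡⟨ collect σ₀ (σ₀ ^ t) a (+ t) c ⟩
    σ₀ * σ₀ ^ t * (a + (1ℤ + + t) * c)                ∎
    where collect : ∀ s P a t c → s * (P * (a + t * c)) + P * (s * c) ≡ s * P * (a + (1ℤ + t) * c)
          collect = solve-∀

  orbitAt-AA≈ : ∀ i T → orbitAt N r w (AA N a d) i (+ T) ≈ σ₀ ^ T * (a + ⟪ i ⟫ + + T * c)
  orbitAt-AA≈ i T = begin
    iter N r w T (AA N a d) i                    ≡⟨ iter-AA T i ⟩
    offset T + σ₀ ^ T * ⟪ i ⟫                    ≈⟨ +-congʳ (σ₀ ^ T * ⟪ i ⟫) (offset≈ T) ⟩
    σ₀ ^ T * (a + + T * c) + σ₀ ^ T * ⟪ i ⟫      ≡⟨ collect (σ₀ ^ T) a (+ T) c ⟪ i ⟫ ⟩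
    σ₀ ^ T * (a + ⟪ i ⟫ + + T * c)               ∎
    where collect : ∀ P a t c x → P * (a + t * c) + P * x ≡ P * (a + x + t * c)
          collect = solve-∀

  module _ (α : ℕ) (σᵅ≈1 : σ₀ ^ α ≈ 1ℤ) where

    ^-row-periodic : ∀ {εₙ} → IsSign εₙ → ∀ {T T₀} l →
                     + T ≡ + T₀ + εₙ * (+ α * + l) → σ₀ ^ T ≈ σ₀ ^ T₀
    ^-row-periodic {εₙ} εₙ± {T} {T₀} l T≡
      with signed-shift εₙ± (α ℕ.* l) (trans T≡ (cong (λ x → + T₀ + εₙ * x) (sym (ℤP.pos-* α l))))
    ... | inj₁ refl = ^-periodic {α = α} σᵅ≈1 T₀ l
    ... | inj₂ refl = ≈-sym (^-periodic {α = α} σᵅ≈1 T l)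

    orbitAt-translate :
      ∀ {z₀ z} → 0ℤ ℤ.≤ z₀ → 0ℤ ℤ.≤ z →
      ∀ {εₙ} → IsSign εₙ → ∀ lₙ → z ≡ z₀ + εₙ * (+ α * + lₙ) →
      ∀ {i₀ i} (ε′ : Fin N → ℤ) (l′ : Fin N → ℕ) → (∀ u → i u ≡ i₀ u + ε′ u * (+ α * + l′ u)) →
      orbitAt N r w (AA N a d) i z ≈
        orbitAt N r w (AA N a d) i₀ z₀
          + + α * powℤ σ₀ σinv z₀ * (sumFin N (λ u → ε′ u * d u * + l′ u) + εₙ * c * + lₙ)
    orbitAt-translate {+ T₀} {+ T} _ _ {εₙ} εₙ± lₙ z≡ {i₀} {i} ε′ l′ i≡ = begin
      orbitAt N r w (AA N a d) i (+ T)
        ≈⟨ orbitAt-AA≈ i T ⟩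
      σ₀ ^ T * (a + ⟪ i ⟫ + + T * c)
        ≈⟨ *-congʳ (a + ⟪ i ⟫ + + T * c) (^-row-periodic εₙ± lₙ z≡) ⟩
      σ₀ ^ T₀ * (a + ⟪ i ⟫ + + T * c)
        ≡⟨ cong₂ (λ x y → σ₀ ^ T₀ * (a + x + y * c)) (⟪⟫-translate α {i₀} ε′ l′ i≡) z≡ ⟩
      σ₀ ^ T₀ * (a + (⟪ i₀ ⟫ + + α * Σ′) + (+ T₀ + εₙ * (+ α * + lₙ)) * c)
        ≡⟨ collect (σ₀ ^ T₀) a ⟪ i₀ ⟫ (+ α) Σ′ (+ T₀) εₙ (+ lₙ) c ⟩
      σ₀ ^ T₀ * (a + ⟪ i₀ ⟫ + + T₀ * c) + + α * σ₀ ^ T₀ * (Σ′ + εₙ * c * + lₙ)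
        ≈⟨ +-congʳ (+ α * σ₀ ^ T₀ * (Σ′ + εₙ * c * + lₙ)) (≈-sym (orbitAt-AA≈ i₀ T₀)) ⟩
      orbitAt N r w (AA N a d) i₀ (+ T₀) + + α * σ₀ ^ T₀ * (Σ′ + εₙ * c * + lₙ) ∎
      where
      Σ′ = sumFin N (λ u → ε′ u * d u * + l′ u)
      collect : ∀ P a x A Σ t e l c →
                P * (a + (x + A * Σ) + (t + e * (A * l)) * c) ≡ P * (a + x + t * c) + A * P * (Σ + e * c * l)
      collect = solve-∀

    shift-by-multiple : ∀ j e k l → j + e * + (k ℕ.+ α ℕ.* l) ≡ (j + e * + k) + e * (+ α * + l)
    shift-by-multiple j e k l =
      trans (cong (λ x → j + e * x) (trans (ℤP.pos-+ k (α ℕ.* l)) (cong (_+_ (+ k)) (ℤP.pos-* α l))))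
            (regroup j e (+ k) (+ α * + l))
      where regroup : ∀ j e k x → j + e * (k + x) ≡ (j + e * k) + e * x
            regroup = solve-∀

    entry-translate :
      ∀ (ε : Vec ℤ (suc N)) → All IsSign ε → ∀ jpos jn (k l : Vec ℕ (suc N)) →
      let kαl = zipWith (λ ku lu → ku ℕ.+ α ℕ.* lu) k l
          z₀  = + jn + lookup ε (fromℕ N) * + lookup k (fromℕ N) in
      0ℤ ℤ.≤ z₀ → 0ℤ ℤ.≤ + jn + lookup ε (fromℕ N) * + lookup kαl (fromℕ N) →
      entry N r w (AA N a d) jpos jn ε kαl ≈
        entry N r w (AA N a d) jpos jn ε k
          + dot (map (λ x → + α * powℤ σ₀ σinv z₀ * x) (zipWith _*_ ε (dTilde N r w σinv d))) l
    entry-translate ε ε± jpos jn k l z₀≥0 z≥0 = begin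
      entry N r w (AA N a d) jpos jn ε kαl
        ≈⟨ orbitAt-translate z₀≥0 z≥0 (lookup⁺ ε± (fromℕ N)) (lookup l (fromℕ N)) (shift (fromℕ N) (+ jn))
                             (λ u → lookup ε (inject₁ u)) (λ u → lookup l (inject₁ u)) (λ u → shift (inject₁ u) (jpos u)) ⟩
      entry N r w (AA N a d) jpos jn ε k + + α * P * Δ
        ≡⟨ cong (_+_ (entry N r w (AA N a d) jpos jn ε k))
                (sym (trans (dot-map-*ˡ (+ α * P) (zipWith _*_ ε (dTilde N r w σinv d)) l)
                            (cong (_*_ (+ α * P)) (dot-zipWith-*-∷ʳ N ε d c l)))) ⟩
      entry N r w (AA N a d) jpos jn ε k + dot (map (λ x → + α * P * x) (zipWith _*_ ε (dTilde N r w σinv d))) l ∎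
      where
      kαl = zipWith (λ ku lu → ku ℕ.+ α ℕ.* lu) k l
      P = powℤ σ₀ σinv (+ jn + lookup ε (fromℕ N) * + lookup k (fromℕ N))
      Δ = sumFin N (λ u → lookup ε (inject₁ u) * d u * + lookup l (inject₁ u))
          + lookup ε (fromℕ N) * c * + lookup l (fromℕ N)
      shift : ∀ i j → j + lookup ε i * + lookup kαl i ≡ (j + lookup ε i * + lookup k i) + lookup ε i * (+ α * + lookup l i)
      shift i j = trans (cong (λ x → j + lookup ε i * + x) (VecP.lookup-zipWith _ i k l))
                        (shift-by-multiple j (lookup ε i) (lookup k i) (lookup l i))

proposition2p11 : (N : ℕ) → 1 ≤ N →
    (m : ℕ) → 1 ≤ m →
    (r : ℕ) (w : Array N) →
    (σinv : ℤ) → σ N r w * σinv ≡ 1ℤ [mod m ] →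
    (a : ℤ) (d : Fin N → ℤ) →
    (α s t : ℕ) → .{{_ : NonZero α}} → 1 ≤ s →
    (∃ λ o → IsMultOrder m (σ N r w) o × o ℕD.∣ α) →
    + s ≡ - (+ t) [mod α ] → t ≤ N → t < α →
    (ε : Vec ℤ (suc N)) → All IsSign ε →
    (jpos : Fin N → ℤ) (jn : ℕ) → Appears N jn ε s →
    (k : Vec ℕ (suc N)) → All (_< α) k →
    MultisetEq m
    (SS N r w (AA N a d) jpos jn ε α s k)
    (AS (suc N)
    (entry N r w (AA N a d) jpos jn ε k)
    (map (λ x → + α * powℤ (σ N r w) σinv (+ jn + lookup ε (fromℕ N) * + lookup k (fromℕ N)) * x)
    (zipWith _*_ ε (dTilde N r w σinv d)))
    (+ ⌈ s / α ⌉ - + ((vsum k ℕ.+ t) ℕ./ α)))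
proposition2p11 N _ m _ r w σinv σσinv≡1 a d α (suc s′) t _ (o , (_ , σᵒ≡1 , _) , o∣α) s≡-t _ t<α
                ε ε± jpos jn appears k _ =
    Σ-↔-⇔ ℕP.≤-irrelevant ℤP.≤-irrelevant index-range⇔
  , λ (l , fits) → ≈⇒≡-mod (entry-translate α σᵅ≈1 ε ε± jpos jn k l (appears k (k-fits l fits)) (appears (kαl l) fits))
  where
  open Congruence m
  open RowsModulo N r w a d m σinv (≡-mod⇒≈ σσinv≡1)
  σᵅ≈1 : σ N r w ^ α ≈ 1ℤ
  σᵅ≈1 = ^-≈1-multiple (≡-mod⇒≈ σᵒ≡1) o∣α
  kαl : Vec ℕ (suc N) → Vec ℕ (suc N)
  kαl l = zipWith (λ ku lu → ku ℕ.+ α ℕ.* lu) k l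
  k-fits : ∀ l → vsum (kαl l) ≤ s′ → vsum k ≤ s′
  k-fits l fits = ℕP.≤-trans (ℕP.m≤m+n (vsum k) (α ℕ.* vsum l)) (subst (_≤ s′) (vsum-zipWith-+-* α k l) fits)
  in-range : Vec ℕ (suc N) → Set
  in-range l = + vsum l ℤ.≤ + ⌈ suc s′ / α ⌉ - + ((vsum k ℕ.+ t) ℕ./ α) - 1ℤ
  index-range⇔ : ∀ l → vsum (kαl l) ≤ s′ ⇔ in-range l
  index-range⇔ l = subst (λ x → x ≤ s′ ⇔ in-range l) (sym (vsum-zipWith-+-* α k l))
    (⇔-sym (+L≤+q-+p-1⇔p+L<q (vsum l) _ _) ⇔-∘ fits⇔ (vsum k) (vsum l) t<α (≡-neg-mod⇒∣+ {suc s′} {t} s≡-t))
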